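{- Let $R: A\to B$ and $S: B\to C$ be morphisms in $\mathrm{CPM}(\mathbf{Rel})$. Then for all $a\in A$ and $c\in C$: $$(S\circ R)(a,a,c,c)\iff \exists b\in B.\ R(a,a,b,b)\wedge S(b,b,c,c).$$
   Context: $\mathbf{Rel}$ is the category of sets and binary relations, with dagger the converse relation. A relation $P: X\to X$ is positive if $P=T^\dagger\circ T$ for some relation $T: X\to Y$. The category $\mathrm{CPM}(\mathbf{Rel})$ has sets as objects; a morphism $A\to B$ is a relation $R\subseteq (A\times A)\times(B\times B)$, written $R(a_1,a_2,b_1,b_2)$, such that the relation $\overline{R}$ on $A\times B$ given by $\overline{R}((a_1,b_1),(a_2,b_2))\iff R(a_2,a_1,b_2,b_1)$ is positive. Composition is $(S\circ R)(a,a',c,c')\iff\exists b,b'\in B.\ R(a,a',b,b')\wedge S(b,b',c,c')$. -}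

module Defs where

open import Data.Product using (Σ; ∃; ∃-syntax; _×_; _,_)
open import Function.Bundles using (_⇔_)

Rel : Set → Set → Set₁
Rel X Y = X → Y → Set

_† : {X Y : Set} → Rel X Y → Rel Y X
(T †) y x = T x y

_∘R_ : {X Y Z : Set} → Rel Y Z → Rel X Y → Rel X Z
(S ∘R T) x z = ∃[ y ] (T x y × S y z)

_≐_ : {X Y : Set} → Rel X Y → Rel X Y → Set
P ≐ Q = ∀ x y → P x y ⇔ Q x y

Positive : {X : Set} → Rel X X → Set₁
Positive {X} P = Σ Set λ Y → Σ (Rel X Y) λ T → P ≐ ((T †) ∘R T)

-- Raw data of a CPM(Rel) morphism A → B: R(a₁,a₂,b₁,b₂).
CPMRel : Set → Set → Set₁
CPMRel A B = A → A → B → B → Set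

bar : {A B : Set} → CPMRel A B → Rel (A × B) (A × B)
bar R (a₁ , b₁) (a₂ , b₂) = R a₂ a₁ b₂ b₁

IsCPM : {A B : Set} → CPMRel A B → Set₁
IsCPM R = Positive (bar R)

_∘CPM_ : {A B C : Set} → CPMRel B C → CPMRel A B → CPMRel A C
(S ∘CPM R) a a' c c' = ∃[ b ] ∃[ b' ] (R a a' b b' × S b b' c c')

module Submission where

-- The key fact is a property of positive relations: if P = T† ∘ T and
-- P x y holds, witnessed by some t with T x t and T y t, then the same t
-- witnesses both P x x and P y y.  So a positive relation is "supported
-- on its diagonal": every related pair lies over two reflexive points.
--
-- For a CPM(Rel) morphism R : A → B this says R(a₁,a₂,b₁,b₂) implies
-- R(a₁,a₁,b₁,b₁) and R(a₂,a₂,b₂,b₂).  The theorem follows: a witness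
-- (b , b') of (S ∘ R)(a,a,c,c) gives R(a,a,b,b') and S(b,b',c,c), whence
-- R(a,a,b,b) and S(b,b,c,c) by the diagonal property; the converse
-- direction takes b' = b.

open import Defs
open import Data.Product using (∃-syntax; _×_; _,_; proj₂)
open import Function.Bundles using (_⇔_; mk⇔; Equivalence)

positive-diagonal : {X : Set} {P : Rel X X} → Positive P →
                    ∀ {x y} → P x y → P x x × P y y
positive-diagonal (Y , T , P≐T†T) {x} {y} pxy
  with Equivalence.to (P≐T†T x y) pxy
... | t , Txt , Tyt =
  Equivalence.from (P≐T†T x x) (t , Txt , Txt) ,
  Equivalence.from (P≐T†T y y) (t , Tyt , Tyt)

-- For a CPM(Rel) morphism, R(a₁,a₂,b₁,b₂) implies R(a₁,a₁,b₁,b₁).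
-- (R̄ relates (a₂,b₂) to (a₁,b₁), so this is the second diagonal point.)
cpm-diagonal : {A B : Set} {R : CPMRel A B} → IsCPM R →
               ∀ {a₁ a₂ b₁ b₂} → R a₁ a₂ b₁ b₂ → R a₁ a₁ b₁ b₁
cpm-diagonal R-cpm r = proj₂ (positive-diagonal R-cpm r)

lemma4p7 : {A B C : Set} (R : CPMRel A B) (S : CPMRel B C) →
    IsCPM R → IsCPM S →
    (a : A) (c : C) →
    (S ∘CPM R) a a c c ⇔ (∃[ b ] (R a a b b × S b b c c))
lemma4p7 R S R-cpm S-cpm a c = mk⇔ to from
  where
  to : (S ∘CPM R) a a c c → ∃[ b ] (R a a b b × S b b c c)
  to (b , b' , r , s) = b , cpm-diagonal R-cpm r , cpm-diagonal S-cpm s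

  from : ∃[ b ] (R a a b b × S b b c c) → (S ∘CPM R) a a c c
  from (b , r , s) = b , b , r , s
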